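{- For all integers $n\ge1$ and $p\ge1$, the number of binary trees with $n$ vertices and hook number $p$ equals the number of rooted ordered trees with $n+1$ vertices having exactly $p$ vertices that are the parent of at least one leaf.
   Context: A binary tree is a rooted tree in which each vertex has either no child, a left child, a right child, or both. For a vertex $v$, its leftmost branch is the maximal chain $v_1,v_2,\dots$ with $v_1$ the left child of $v$ and $v_{j+1}$ the left child of $v_j$; its rightmost branch is defined symmetrically with right children. The hook of $v$ is $\{v\}$ together with its leftmost and rightmost branches. The vertices of a binary tree are partitioned into hooks by taking the hook of the root, removing it, and recursing on each tree of the remaining forest (the subtrees hanging off the removed hook); the number of hooks obtained is the hook number of the tree. A rooted ordered tree is a rooted tree in which the children of each vertex are linearly ordered; a leaf is a vertex with no children. -}

module Defs where

open import Data.Nat using (ℕ; zero; suc; _+_)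
open import Data.Bool using (Bool; true; false; if_then_else_)
open import Data.List using (List; []; _∷_)
open import Data.Bool.ListAction using (any)

data BTree : Set where
  empty : BTree
  node  : BTree → BTree → BTree

bsize : BTree → ℕ
bsize empty      = 0
bsize (node l r) = suc (bsize l + bsize r)

-- Hook number: remove the hook of the root (root, its leftmost branch and its
-- rightmost branch) and recurse on the subtrees hanging off the hook:
-- the right subtrees of the vertices on the leftmost branch and the left
-- subtrees of the vertices on the rightmost branch.
mutual
  hookNumber : BTree → ℕ
  hookNumber empty      = 0
  hookNumber (node l r) = suc (leftBranchRest l + rightBranchRest r)

  leftBranchRest : BTree → ℕ
  leftBranchRest empty      = 0
  leftBranchRest (node l r) = hookNumber r + leftBranchRest l

  rightBranchRest : BTree → ℕ
  rightBranchRest empty      = 0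
  rightBranchRest (node l r) = hookNumber l + rightBranchRest r

data OTree : Set where
  nd : List OTree → OTree

mutual
  osize : OTree → ℕ
  osize (nd ts) = suc (osizes ts)

  osizes : List OTree → ℕ
  osizes []       = 0
  osizes (t ∷ ts) = osize t + osizes ts

isLeaf : OTree → Bool
isLeaf (nd [])      = true
isLeaf (nd (_ ∷ _)) = false

mutual
  leafParents : OTree → ℕ
  leafParents (nd ts) = (if any isLeaf ts then 1 else 0) + leafParentsList ts

  leafParentsList : List OTree → ℕ
  leafParentsList []       = 0
  leafParentsList (t ∷ ts) = leafParents t + leafParentsList ts

module Submission where

open import Defs
open import Data.Nat using (ℕ; suc; _+_; _≤_)
open import Data.Product using (Σ; _×_)
open import Function.Bundles using (_↔_)
open import Relation.Binary.PropositionalEquality using (_≡_)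

open import Data.Nat.Properties using (≡-irrelevant; +-comm; +-cancelʳ-≡; +-identityʳ)
open import Data.Nat.Tactic.RingSolver using (solve-∀)
open import Data.Product using (_,_; map₁; uncurry)
open import Data.Product.Function.Dependent.Propositional using (Σ-↔)
open import Data.Product.Function.NonDependent.Propositional using (_×-↔_)
open import Data.List using (List; []; _∷_)
open import Data.Bool using (if_then_else_)
open import Data.Bool.ListAction using (any)
open import Function.Base using (_∘_)
open import Function.Bundles using (mk↔ₛ′)
open import Relation.Binary.PropositionalEquality using (refl; sym; trans; cong; cong₂)

-- A nonempty binary tree node l r is encoded as the forest of children of a
-- new root, by walking down its hook.  Along the leftmost branch, a vertex
-- whose right subtree a is nonempty contributes a sibling tree carrying the
-- encoding of a, whereas a vertex with empty right subtree pushes the rest of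
-- the encoding one level deeper.  At the bottom of the branch a leaf is placed,
-- followed by one tree per vertex of the rightmost branch carrying the encoding
-- of its left subtree.  Only the bottom level contains a leaf, so every hook
-- yields exactly one parent of a leaf; each binary vertex yields one vertex of
-- the forest; and every step can be read back from the first tree of a forest
-- (a leaf, or an internal vertex with or without younger siblings).

mutual
  encode : BTree → List OTree
  encode empty      = []
  encode (node l r) = uncurry _∷_ (encodeHook l r)

  encodeHook : BTree → BTree → OTree × List OTree
  encodeHook empty               r = nd [] , encodeRightBranch r
  encodeHook (node l empty)      r = nd (uncurry _∷_ (encodeHook l r)) , []
  encodeHook (node l (node a b)) r =
    nd (uncurry _∷_ (encodeHook a b)) , uncurry _∷_ (encodeHook l r)

  encodeRightBranch : BTree → List OTree
  encodeRightBranch empty      = []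
  encodeRightBranch (node l r) = nd (encode l) ∷ encodeRightBranch r

mutual
  decode : List OTree → BTree
  decode []       = empty
  decode (t ∷ ts) = uncurry node (decodeHook t ts)

  decodeHook : OTree → List OTree → BTree × BTree
  decodeHook (nd [])       ts       = empty , decodeRightBranch ts
  decodeHook (nd (c ∷ cs)) []       = map₁ (λ l → node l empty) (decodeHook c cs)
  decodeHook (nd (c ∷ cs)) (t ∷ ts) = map₁ (λ l → node l (decode (c ∷ cs))) (decodeHook t ts)

  decodeRightBranch : List OTree → BTree
  decodeRightBranch []           = empty
  decodeRightBranch (nd cs ∷ ts) = node (decode cs) (decodeRightBranch ts)

mutual
  decode-encode : ∀ t → decode (encode t) ≡ t
  decode-encode empty      = refl
  decode-encode (node l r) = cong (uncurry node) (decodeHook-encodeHook l r)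

  decodeHook-encodeHook : ∀ l r → uncurry decodeHook (encodeHook l r) ≡ (l , r)
  decodeHook-encodeHook empty               r =
    cong (empty ,_) (decodeRightBranch-encodeRightBranch r)
  decodeHook-encodeHook (node l empty)      r =
    cong (map₁ (λ x → node x empty)) (decodeHook-encodeHook l r)
  decodeHook-encodeHook (node l (node a b)) r =
    cong₂ (λ d → map₁ (λ x → node x d)) (decode-encode (node a b)) (decodeHook-encodeHook l r)

  decodeRightBranch-encodeRightBranch : ∀ t → decodeRightBranch (encodeRightBranch t) ≡ t
  decodeRightBranch-encodeRightBranch empty      = refl
  decodeRightBranch-encodeRightBranch (node l r) =
    cong₂ node (decode-encode l) (decodeRightBranch-encodeRightBranch r)

mutual
  encode-decode : ∀ ts → encode (decode ts) ≡ ts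
  encode-decode []       = refl
  encode-decode (t ∷ ts) = cong (uncurry _∷_) (encodeHook-decodeHook t ts)

  encodeHook-decodeHook : ∀ t ts → uncurry encodeHook (decodeHook t ts) ≡ (t , ts)
  encodeHook-decodeHook (nd [])       ts       =
    cong (nd [] ,_) (encodeRightBranch-decodeRightBranch ts)
  encodeHook-decodeHook (nd (c ∷ cs)) []       =
    cong (λ xs → nd xs , []) (encode-decode (c ∷ cs))
  encodeHook-decodeHook (nd (c ∷ cs)) (t ∷ ts) =
    cong₂ (λ xs ys → nd xs , ys) (encode-decode (c ∷ cs)) (encode-decode (t ∷ ts))

  encodeRightBranch-decodeRightBranch : ∀ ts → encodeRightBranch (decodeRightBranch ts) ≡ ts
  encodeRightBranch-decodeRightBranch []           = refl
  encodeRightBranch-decodeRightBranch (nd cs ∷ ts) =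
    cong₂ (λ xs ys → nd xs ∷ ys) (encode-decode cs) (encodeRightBranch-decodeRightBranch ts)

mutual
  osizes-encode : ∀ t → osizes (encode t) ≡ bsize t
  osizes-encode empty      = refl
  osizes-encode (node l r) = osizes-encodeHook l r

  osizes-encodeHook : ∀ l r → osizes (uncurry _∷_ (encodeHook l r)) ≡ suc (bsize l + bsize r)
  osizes-encodeHook empty               r = cong suc (osizes-encodeRightBranch r)
  osizes-encodeHook (node l empty)      r =
    trans (cong (λ s → suc s + 0) (osizes-encodeHook l r)) (arith (bsize l) (bsize r))
    where
    arith : ∀ L R → suc (suc (L + R)) + 0 ≡ suc (suc (L + 0) + R)
    arith = solve-∀
  osizes-encodeHook (node l (node a b)) r =
    trans (cong₂ (λ s s′ → suc s + s′) (osizes-encodeHook a b) (osizes-encodeHook l r))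
          (arith (bsize a) (bsize b) (bsize l) (bsize r))
    where
    arith : ∀ A B L R → suc (suc (A + B)) + suc (L + R) ≡ suc (suc (L + suc (A + B)) + R)
    arith = solve-∀

  osizes-encodeRightBranch : ∀ t → osizes (encodeRightBranch t) ≡ bsize t
  osizes-encodeRightBranch empty      = refl
  osizes-encodeRightBranch (node l r) =
    cong₂ (λ s s′ → suc s + s′) (osizes-encode l) (osizes-encodeRightBranch r)

-- The grafted vertex is not a leaf, so it leaves the leaf test of its new parent unchanged.
leafParents-graft : ∀ (cs : OTree × List OTree) ts →
  leafParents (nd (nd (uncurry _∷_ cs) ∷ ts))
    ≡ leafParents (nd (uncurry _∷_ cs)) + leafParents (nd ts)
leafParents-graft cs ts =
  arith (if any isLeaf ts then 1 else 0) (leafParents (nd (uncurry _∷_ cs))) (leafParentsList ts)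
  where
  arith : ∀ i h L → i + (h + L) ≡ h + (i + L)
  arith = solve-∀

mutual
  leafParents-encode : ∀ t → leafParents (nd (encode t)) ≡ hookNumber t
  leafParents-encode empty      = refl
  leafParents-encode (node l r) = leafParents-encodeHook l r

  leafParents-encodeHook : ∀ l r →
    leafParents (nd (uncurry _∷_ (encodeHook l r))) ≡ suc (leftBranchRest l + rightBranchRest r)
  leafParents-encodeHook empty               r = cong suc (leafParentsList-encodeRightBranch r)
  leafParents-encodeHook (node l empty)      r =
    trans (leafParents-graft (encodeHook l r) [])
          (trans (+-identityʳ _) (leafParents-encodeHook l r))
  leafParents-encodeHook (node l (node a b)) r =
    trans (leafParents-graft (encodeHook a b) (uncurry _∷_ (encodeHook l r)))
          (trans (cong₂ _+_ (leafParents-encodeHook a b) (leafParents-encodeHook l r))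
                 (arith (hookNumber (node a b)) (leftBranchRest l) (rightBranchRest r)))
    where
    arith : ∀ h L R → h + suc (L + R) ≡ suc ((h + L) + R)
    arith = solve-∀

  leafParentsList-encodeRightBranch : ∀ t → leafParentsList (encodeRightBranch t) ≡ rightBranchRest t
  leafParentsList-encodeRightBranch empty      = refl
  leafParentsList-encodeRightBranch (node l r) =
    cong₂ _+_ (leafParents-encode l) (leafParentsList-encodeRightBranch r)

plantEncoding : BTree ↔ OTree
plantEncoding = mk↔ₛ′ (nd ∘ encode) (λ { (nd ts) → decode ts })
  (λ { (nd ts) → cong nd (encode-decode ts) }) decode-encode

osize-plantEncoding : ∀ t → osize (nd (encode t)) ≡ bsize t + 1
osize-plantEncoding t = trans (cong suc (osizes-encode t)) (+-comm 1 (bsize t))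

≡-↔-≡ : {a b c d : ℕ} → (a ≡ c → b ≡ d) → (b ≡ d → a ≡ c) → (a ≡ c) ↔ (b ≡ d)
≡-↔-≡ to from = mk↔ₛ′ to from (λ _ → ≡-irrelevant _ _) (λ _ → ≡-irrelevant _ _)

-- The bijection does not need the hypotheses 1 ≤ n and 1 ≤ p.
mainTheorem7 : (n p : ℕ) → 1 ≤ n → 1 ≤ p →
    (Σ BTree (λ t → (bsize t ≡ n) × (hookNumber t ≡ p)))
      ↔ (Σ OTree (λ t → (osize t ≡ n + 1) × (leafParents t ≡ p)))
mainTheorem7 n p _ _ = Σ-↔ plantEncoding (sizes ×-↔ hooks)
  where
  sizes : ∀ {t} → (bsize t ≡ n) ↔ (osize (nd (encode t)) ≡ n + 1)
  sizes {t} = ≡-↔-≡ (λ e → trans (osize-plantEncoding t) (cong (_+ 1) e))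
                    (λ e → +-cancelʳ-≡ 1 _ _ (trans (sym (osize-plantEncoding t)) e))
  hooks : ∀ {t} → (hookNumber t ≡ p) ↔ (leafParents (nd (encode t)) ≡ p)
  hooks {t} = ≡-↔-≡ (trans (leafParents-encode t)) (trans (sym (leafParents-encode t)))
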